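{- Let $\sigma = \textrm{Prop} \cup \mathbb{A}$ be a modal signature with $\mathbb{A} = \{R_i \mid i \in I\}$, $I$ finite. If $M_a$ and $N_b$ are degree-finite $\sigma$-LTSs, then $M_a$ and $N_b$ satisfy the same formulas of $\textrm{ML}^{+,B,k}_\Diamond$ over $\sigma$ if and only if $\textrm{hom}_{\mathbb{B}}(\mathcal{A}^k_\sigma,M_a) = \textrm{hom}_{\mathbb{B}}(\mathcal{A}^k_\sigma,N_b)$.
   Context: A $\sigma$-LTS is a structure over a modal signature $\sigma$ (finitely many unary proposition letters and binary actions $R_i$, $i\in I$) with one distinguished element. It is degree-finite if every state has finitely many $\sigma$-successors and finitely many $\sigma$-predecessors. $\textrm{ML}^+_\Diamond$ (positive-existential modal logic) is built from proposition letters using $\land$, $\lor$ and the modalities $\Diamond_i$ (no negation, no box). A backward modality for action $R_i$, written here $\Diamond^{ -,\geq k}_i$ (a "black diamond" in the paper), has semantics: $M,a \models \Diamond^{ -,\geq k}_i \varphi$ iff there are at least $k$ elements $b$ with $R_i^M(b,a)$ and $M,b\models\varphi$. $\textrm{ML}^{+,B}_\Diamond$ is the extension of $\textrm{ML}^+_\Diamond$ with the backward modalities $\Diamond^{ -,\geq 1}_i$, and $\textrm{ML}^{+,B,k}_\Diamond$ is its fragment of formulas of modal depth at most $k$. $\mathcal{A}^k_\sigma$ is the class of finite connected acyclic $\sigma$-LTSs of depth at most $k$ (connectedness and acyclicity via undirected paths of binary facts; depth of a state is the length of the shortest such path from the distinguished element). $\textrm{hom}_{\mathbb{B}}(\mathcal{C},M_a)$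 is the vector indexed by $\mathcal{C}$ whose entry at $T_c$ is $1$ if there is a homomorphism from $T_c$ to $M_a$ mapping $c$ to $a$ and $0$ otherwise (Boolean semiring counting).
   Formalization: The formulas of $\textrm{ML}^{+,B,k}_\Diamond$ also include the constant ⊤, true at every state and of modal depth 0. The statement above fails without it. -}

module Defs where

open import Data.Nat using (ℕ; zero; suc; _≤_; _⊔_)
open import Data.Fin using (Fin; inject₁; fromℕ) renaming (zero to fzero; suc to fsuc)
open import Data.Bool using (Bool; true)
open import Data.Product using (Σ; ∃; ∃-syntax; _×_; _,_)
open import Data.Sum using (_⊎_)
open import Data.Unit using (⊤)
open import Data.List using (List)
open import Data.List.Membership.Propositional using (_∈_)
open import Relation.Binary.PropositionalEquality using (_≡_)
open import Function.Definitions using (Injective)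
open import Function.Bundles using (_⇔_)
open import Level using (0ℓ)

-- Modal signature σ = Prop ∪ {R_i | i ∈ I}: p proposition letters
-- (indexed by Fin p) and finitely many actions I = Fin n.

record LTS (p n : ℕ) : Set₁ where
  field
    State : Set
    prop  : Fin p → State → Set
    rel   : Fin n → State → State → Set
    point : State
open LTS public

DegreeFinite : ∀ {p n} → LTS p n → Set
DegreeFinite M =
  ∀ (s : State M) (i : Fin _) →
    (∃[ xs ] ∀ t → (rel M i s t ⇔ t ∈ xs)) ×
    (∃[ xs ] ∀ t → (rel M i t s ⇔ t ∈ xs))

data Form (p n : ℕ) : Set where
  tt   : Form p n
  var  : Fin p → Form p n
  _∧_  : Form p n → Form p n → Form p n
  _∨_  : Form p n → Form p n → Form p n
  dia  : Fin n → Form p n → Form p n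
  bdia : Fin n → Form p n → Form p n

md : ∀ {p n} → Form p n → ℕ
md tt         = 0
md (var x)    = 0
md (φ ∧ ψ)    = md φ ⊔ md ψ
md (φ ∨ ψ)    = md φ ⊔ md ψ
md (dia i φ)  = suc (md φ)
md (bdia i φ) = suc (md φ)

_⊨_at_ : ∀ {p n} (M : LTS p n) → Form p n → State M → Set
M ⊨ tt at s       = ⊤
M ⊨ var x at s    = prop M x s
M ⊨ (φ ∧ ψ) at s  = (M ⊨ φ at s) × (M ⊨ ψ at s)
M ⊨ (φ ∨ ψ) at s  = (M ⊨ φ at s) ⊎ (M ⊨ ψ at s)
M ⊨ dia i φ at s  = ∃[ t ] (rel M i s t × (M ⊨ φ at t))
M ⊨ bdia i φ at s = ∃[ t ] (rel M i t s × (M ⊨ φ at t))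

SameFormulas : ∀ {p n} → ℕ → LTS p n → LTS p n → Set
SameFormulas k M N =
  ∀ (φ : Form _ _) → md φ ≤ k → ((M ⊨ φ at point M) ⇔ (N ⊨ φ at point N))

record FinLTS (p n : ℕ) : Set where
  field
    size  : ℕ
    fprop : Fin p → Fin size → Bool
    frel  : Fin n → Fin size → Fin size → Bool
    root  : Fin size
open FinLTS public

Fact : ∀ {p n} → FinLTS p n → Set
Fact {n = n} T = Fin n × Fin (size T) × Fin (size T)

IsFact : ∀ {p n} (T : FinLTS p n) → Fact T → Set
IsFact T (i , x , y) = frel T i x y ≡ true

Links : ∀ {p n} (T : FinLTS p n) → Fact T → Fin (size T) → Fin (size T) → Set
Links T (i , u , v) x y = IsFact T (i , u , v) × ((u ≡ x × v ≡ y) ⊎ (u ≡ y × v ≡ x))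

data Walk {p n} (T : FinLTS p n) : Fin (size T) → Fin (size T) → ℕ → Set where
  nil  : ∀ x → Walk T x x 0
  step : ∀ {x y z l} (f : Fact T) → Links T f x y → Walk T y z l → Walk T x z (suc l)

Connected : ∀ {p n} → FinLTS p n → Set
Connected T = ∀ x → ∃[ l ] Walk T (root T) x l

-- A cycle: l+1 ≥ 1 pairwise distinct vertices v₀ … v_l, closing up
-- (v_{l+1} = v₀), joined consecutively by l+1 pairwise distinct facts.
record Cycle {p n} (T : FinLTS p n) : Set where
  field
    len    : ℕ
    vert   : Fin (suc (suc len)) → Fin (size T)
    closes : vert (fromℕ (suc len)) ≡ vert fzero
    edge   : Fin (suc len) → Fact T
    links  : ∀ j → Links T (edge j) (vert (inject₁ j)) (vert (fsuc j))
    vinj   : Injective _≡_ _≡_ (λ j → vert (inject₁ j))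
    einj   : Injective _≡_ _≡_ edge

Acyclic : ∀ {p n} → FinLTS p n → Set
Acyclic T = Cycle T → Data.Empty.⊥
  where import Data.Empty

DepthAtMost : ∀ {p n} → ℕ → FinLTS p n → Set
DepthAtMost k T = ∀ x → ∃[ l ] (l ≤ k × Walk T (root T) x l)

InA : ∀ {p n} → ℕ → FinLTS p n → Set
InA k T = Connected T × Acyclic T × DepthAtMost k T

record Hom {p n} (T : FinLTS p n) (M : LTS p n) : Set where
  field
    map      : Fin (size T) → State M
    pres-prop : ∀ j x → fprop T j x ≡ true → prop M j (map x)
    pres-rel  : ∀ i x y → frel T i x y ≡ true → rel M i (map x) (map y)
    pres-pt   : map (root T) ≡ point M

-- hom_𝔹(𝒜^k_σ, M_a) = hom_𝔹(𝒜^k_σ, N_b): entrywise equality of the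
-- Boolean vectors, i.e. the entry at T_c is 1 for M iff it is 1 for N.
HomVecEq : ∀ {p n} → ℕ → LTS p n → LTS p n → Set
HomVecEq k M N = ∀ (T : FinLTS _ _) → InA k T → (Hom T M ⇔ Hom T N)

-- A positive formula holds at a state iff one of its disjuncts does, and a disjunct, a conjunction
-- of atoms and nested forward and backward diamonds, is the same as a tree in 𝒜^k together with a
-- homomorphism from it into the structure; so equal hom-vectors give equal formulas. Conversely each
-- T ∈ 𝒜^k has a characteristic formula χ of depth k, its unravelling from the root, which holds
-- wherever T maps. Acyclicity makes every fact of T a fact between a vertex and its breadth-first
-- parent, so T is its own unravelling and any state satisfying χ is the image of the root of T.

module Submission where

open import Defs
open import Data.Nat as ℕ using (ℕ; zero; suc; _≤_; _<_; _⊔_; _+_; _∸_; z≤n; s≤s; s≤s⁻¹)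
open import Data.Nat.Properties
  using (≤-refl; ≤-reflexive; ≤-trans; ≤-antisym; <-trans; <-asym; <-irrefl; <-≤-trans; ≤∧≢⇒<; <⇒≢; <⇒≤;
         ≰⇒>; ≮⇒≥; n≤0⇒n≡0; m<n⇒m<1+n; m≤n⇒m<n∨m≡n; 1+n≢n; 0≢1+n; suc-injective; +-identityʳ; +-suc;
         +-∸-assoc; ⊔-lub; ⊔-mono-≤; m≤n⇒m≤n⊔o; m≤n⇒m≤o⊔n; ≤-totalOrder)
open import Data.Fin as Fin using (Fin; inject₁; fromℕ; toℕ; _↑ˡ_; _↑ʳ_; splitAt; join)
  renaming (zero to fzero; suc to fsuc)
open import Data.Fin.Properties
  using (toℕ-inject₁; toℕ-fromℕ; toℕ-injective; toℕ<n; splitAt-↑ˡ; splitAt-↑ʳ; join-splitAt; any?)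
  renaming (0≢1+n to fzero≢fsuc)
open import Data.Fin.Relation.Unary.Top using (view; ‵fromℕ; ‵inject₁)
open import Data.Bool using (Bool; true; false)
open import Data.Bool.Properties using () renaming (_≟_ to _≟ᵇ_)
open import Data.Maybe using (Maybe; just; nothing)
import Data.Maybe as Maybe
import Data.Maybe.Properties as Maybe
import Data.Product.Properties as Product
open import Data.Product using (Σ; ∃-syntax; ∃₂; _×_; _,_; proj₁; proj₂)
open import Data.Sum using (_⊎_; inj₁; inj₂; swap; [_,_]; [_,_]′)
open import Data.Unit using (⊤; tt)
open import Data.Empty using (⊥)
open import Data.List using (allFin)
import Data.List.Relation.Unary.All as All
open import Data.List.Membership.Propositional.Properties using (∈-allFin)
open import Data.List.Extrema ≤-totalOrder using (argmax; f[xs]≤f[argmax])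
open import Function using (_∘_)
open import Function.Bundles using (_⇔_; mk⇔; Equivalence)
open import Relation.Binary.PropositionalEquality hiding ([_])
open import Relation.Binary.Definitions using (DecidableEquality)
open import Relation.Nullary using (Dec; yes; no; does; ¬_; contradiction)
open import Relation.Nullary.Decidable using (dec-true; map′; _×-dec_; _⊎-dec_)

private variable
  p n : ℕ

maximum : ∀ {m} (f : Fin (suc m) → ℕ) → Σ (Fin (suc m)) λ t → ∀ j → f j ≤ f t
maximum f = argmax f fzero (allFin _) , λ j → All.lookup (f[xs]≤f[argmax] {f = f} fzero (allFin _)) (∈-allFin j)

fsuc≢inject₁ : ∀ {m} (j : Fin m) → fsuc j ≢ inject₁ j
fsuc≢inject₁ j e = 1+n≢n (trans (cong toℕ e) (toℕ-inject₁ j))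

subst₃ : ∀ {A B C : Set} (R : A → B → C → Set) {a a′ b b′ c c′} → a ≡ a′ → b ≡ b′ → c ≡ c′ → R a b c → R a′ b′ c′
subst₃ R refl refl refl r = r

_[_↦_] : {A : Set} → (ℕ → A) → ℕ → A → ℕ → A
(s [ m ↦ a ]) j with j ℕ.≟ m
... | yes _ = a
... | no _  = s j

module _ {A : Set} (s : ℕ → A) where

  ↦-hit : ∀ m a → (s [ m ↦ a ]) m ≡ a
  ↦-hit m a with m ℕ.≟ m
  ... | yes _ = refl
  ... | no m≢m = contradiction refl m≢m

  ↦-miss : ∀ {m a j} → j ≢ m → (s [ m ↦ a ]) j ≡ s j
  ↦-miss {m} {j = j} j≢m with j ℕ.≟ m
  ... | yes j≡m = contradiction j≡m j≢m
  ... | no _    = refl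

  ↦-pointwise : ∀ {m a} {P : ℕ → A → Set} → (∀ {j} → j < m → P j (s j)) → P m a →
                ∀ {j} → j < suc m → P j ((s [ m ↦ a ]) j)
  ↦-pointwise {m} {a} {P} below at-m {j} j<1+m with m≤n⇒m<n∨m≡n (s≤s⁻¹ j<1+m)
  ... | inj₁ j<m = subst (P j) (sym (↦-miss (<⇒≢ j<m))) (below j<m)
  ... | inj₂ refl = subst (P m) (sym (↦-hit m a)) at-m

  ↦-injective : ∀ {m a} → (∀ {i j} → i < m → j < m → s i ≡ s j → i ≡ j) → (∀ {j} → j < m → s j ≢ a) →
                ∀ {i j} → i ≤ m → j ≤ m → (s [ m ↦ a ]) i ≡ (s [ m ↦ a ]) j → i ≡ j
  ↦-injective {m} {a} inj fresh {i} {j} i≤m j≤m e with m≤n⇒m<n∨m≡n i≤m | m≤n⇒m<n∨m≡n j≤m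
  ... | inj₁ i<m | inj₁ j<m = inj i<m j<m (trans (sym (↦-miss (<⇒≢ i<m))) (trans e (↦-miss (<⇒≢ j<m))))
  ... | inj₁ i<m | inj₂ refl = contradiction (trans (sym (↦-miss (<⇒≢ i<m))) (trans e (↦-hit m a))) (fresh i<m)
  ... | inj₂ refl | inj₁ j<m = contradiction (trans (sym (↦-miss (<⇒≢ j<m))) (trans (sym e) (↦-hit m a))) (fresh j<m)
  ... | inj₂ refl | inj₂ refl = refl

module WalkProperties (T : FinLTS p n) where

  links-sym : ∀ {f x y} → Links T f x y → Links T f y x
  links-sym (isf , inj₁ (a , b)) = isf , inj₂ (a , b)
  links-sym (isf , inj₂ (a , b)) = isf , inj₁ (a , b)

  links-same-fact : ∀ {f a b c d} → Links T f a b → Links T f c d → (a ≡ c × b ≡ d) ⊎ (a ≡ d × b ≡ c)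
  links-same-fact (_ , inj₁ (refl , refl)) (_ , inj₁ (refl , refl)) = inj₁ (refl , refl)
  links-same-fact (_ , inj₁ (refl , refl)) (_ , inj₂ (refl , refl)) = inj₂ (refl , refl)
  links-same-fact (_ , inj₂ (refl , refl)) (_ , inj₁ (refl , refl)) = inj₂ (refl , refl)
  links-same-fact (_ , inj₂ (refl , refl)) (_ , inj₂ (refl , refl)) = inj₁ (refl , refl)

  walk-snoc : ∀ {x y z l f} → Walk T x y l → Links T f y z → Walk T x z (suc l)
  walk-snoc (nil _)       lk = step _ lk (nil _)
  walk-snoc (step g lg w) lk = step g lg (walk-snoc w lk)

  walk-reverse : ∀ {x y l} → Walk T x y l → Walk T y x l
  walk-reverse (nil _)       = nil _
  walk-reverse (step f lk w) = walk-snoc (walk-reverse w) (links-sym lk)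

  links-extend : ∀ {len} {vertex : ℕ → Fin (size T)} {fact : ℕ → Fact T} {g w} →
    (∀ {j} → j < len → Links T (fact j) (vertex j) (vertex (suc j))) → Links T g (vertex len) w →
    ∀ {j} → j < suc len → Links T ((fact [ len ↦ g ]) j) ((vertex [ suc len ↦ w ]) j) ((vertex [ suc len ↦ w ]) (suc j))
  links-extend {len} {vertex} {fact} {g} {w} lk lg {j} j<1+len with m≤n⇒m<n∨m≡n (s≤s⁻¹ j<1+len)
  ... | inj₁ j<len =
    subst₃ (Links T) (sym (↦-miss fact (<⇒≢ j<len))) (sym (↦-miss vertex (<⇒≢ (m<n⇒m<1+n j<len))))
                     (sym (↦-miss vertex (<⇒≢ (s≤s j<len)))) (lk j<len)
  ... | inj₂ refl =
    subst₃ (Links T) (sym (↦-hit fact len g)) (sym (↦-miss vertex (1+n≢n ∘ sym))) (sym (↦-hit vertex (suc len) w)) lg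

-- Parent maps and acyclicity

record ParentMap (T : FinLTS p n) : Set where
  field
    rank         : Fin (size T) → ℕ
    parent       : Fin (size T) → Maybe (Fin (size T) × Fact T)
    parent-links : ∀ {x y f} → parent x ≡ just (y , f) → Links T f x y
    parent-rank  : ∀ {x y f} → parent x ≡ just (y , f) → suc (rank y) ≡ rank x
    orphan-root  : ∀ {x} → parent x ≡ nothing → x ≡ root T
    rank-root    : rank (root T) ≡ 0

  CoversFacts : Set
  CoversFacts = ∀ {i u v} → IsFact T (i , u , v) →
    parent v ≡ just (u , (i , u , v)) ⊎ parent u ≡ just (v , (i , u , v))

module ParentMapProperties {T : FinLTS p n} (P : ParentMap T) where
  open ParentMap P
  open WalkProperties T

  private
    V : Set
    V = Fin (size T)

  orphan-rank : ∀ {x} → parent x ≡ nothing → rank x ≡ 0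
  orphan-rank e = trans (cong rank (orphan-root e)) rank-root

  rank-zero-root : ∀ {x} → rank x ≡ 0 → x ≡ root T
  rank-zero-root {x} r≡0 with parent x in e
  ... | nothing = orphan-root e
  ... | just _  = contradiction (trans (parent-rank e) r≡0) λ ()

  non-root-parent : ∀ {x} → x ≢ root T → ∃₂ λ y f → parent x ≡ just (y , f)
  non-root-parent {x} x≢r with parent x in e
  ... | nothing      = contradiction (orphan-root e) x≢r
  ... | just (y , f) = y , f , refl

  walk-from-root : ∀ x → Walk T (root T) x (rank x)
  walk-from-root x = go (rank x) x refl
    where
    go : ∀ r x → rank x ≡ r → Walk T (root T) x r
    go zero    x e = subst (λ z → Walk T (root T) z 0) (sym (rank-zero-root e)) (nil _)
    go (suc r) x e with parent x in q
    ... | nothing      = contradiction (trans (sym e) (orphan-rank q)) λ ()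
    ... | just (y , f) = walk-snoc (go r y (suc-injective (trans (parent-rank q) e))) (links-sym (parent-links q))

  parents-agree : ∀ {z x y f g} → parent z ≡ just (x , f) → parent z ≡ just (y , g) → f ≡ g
  parents-agree p q = cong proj₂ (Maybe.just-injective (trans (sym p) q))

  -- Covering parent maps make T a tree: every cycle has a vertex of maximal rank,
  -- and both cycle facts at that vertex would have to be its parent fact.

  module _ (covers : CoversFacts) where

    link-is-parent-link : ∀ {f x y} → Links T f x y → parent x ≡ just (y , f) ⊎ parent y ≡ just (x , f)
    link-is-parent-link {i , _ , _} (isf , inj₁ (refl , refl)) = swap (covers isf)
    link-is-parent-link {i , _ , _} (isf , inj₂ (refl , refl)) = covers isf

    linked-ranks-differ : ∀ {f x y} → Links T f x y → rank x ≢ rank y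
    linked-ranks-differ lk x≡y with link-is-parent-link lk
    ... | inj₁ q = 1+n≢n (trans (parent-rank q) x≡y)
    ... | inj₂ q = 1+n≢n (trans (parent-rank q) (sym x≡y))

    descending-link-is-parent : ∀ {f x y} → Links T f x y → rank y < rank x → parent x ≡ just (y , f)
    descending-link-is-parent {x = x} lk y<x with link-is-parent-link lk
    ... | inj₁ q = q
    ... | inj₂ q = contradiction (subst (rank x <_) (parent-rank q) ≤-refl) (<-asym y<x)

    covering⇒acyclic : Acyclic T
    covering⇒acyclic record { len = zero ; vert = vert ; closes = closes ; links = links } =
      linked-ranks-differ (links fzero) (cong rank (sym closes))
    covering⇒acyclic
      record { len = suc L ; vert = vert ; closes = closes ; edge = edge ; links = links ; einj = einj } =
      no-top (proj₁ highest) (proj₂ highest)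
      where
      v : Fin (suc (suc L)) → V
      v j = vert (inject₁ j)
      highest = maximum (rank ∘ v)
      below : ∀ {m} → (∀ j → rank (v j) ≤ rank (v m)) → ∀ x → rank (vert x) ≤ rank (v m)
      below {m} top x with view x
      ... | ‵fromℕ     = subst (λ z → rank z ≤ rank (v m)) (sym closes) (top fzero)
      ... | ‵inject₁ j = top j
      down : ∀ {m f x} → (∀ j → rank (v j) ≤ rank (v m)) → Links T f (v m) (vert x) → parent (v m) ≡ just (vert x , f)
      down {x = x} top lk = descending-link-is-parent lk (≤∧≢⇒< (below top x) (linked-ranks-differ lk ∘ sym))
      no-top : ∀ m → (∀ j → rank (v j) ≤ rank (v m)) → ⊥
      no-top fzero top = fzero≢fsuc (einj (parents-agree (down top (links fzero)) (down top (links-sym closing))))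
        where
        closing : Links T (edge (fromℕ (suc L))) (vert (inject₁ (fromℕ (suc L)))) (v fzero)
        closing = subst (Links T _ _) closes (links (fromℕ (suc L)))
      no-top (fsuc m) top =
        fsuc≢inject₁ m (einj (parents-agree (down top (links (fsuc m))) (down top (links-sym (links (inject₁ m))))))

  -- Conversely, in an acyclic T every fact (i , u , v) is a parent fact: otherwise the path
  -- from u to v through parent facts, closed up by (i , u , v), is a cycle.
  -- A vertex of a tree path from a to b other than a and b has rank below that of a or b;
  -- this keeps the vertex added by cons-path or snoc-path fresh.
  RankBelow : V → V → Set
  RankBelow a x = x ≡ a ⊎ rank x < rank a

  record TreePath (a b : V) : Set where
    field
      len       : ℕ
      vertex    : ℕ → V
      fact      : ℕ → Fact T
      starts    : vertex 0 ≡ a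
      ends      : vertex len ≡ b
      link      : ∀ {j} → j < len → Links T (fact j) (vertex j) (vertex (suc j))
      parental  : ∀ {j} → j < len → ∃₂ λ z y → parent z ≡ just (y , fact j)
      distinct  : ∀ {i j} → i ≤ len → j ≤ len → vertex i ≡ vertex j → i ≡ j
      near-ends : ∀ {j} → j ≤ len → RankBelow a (vertex j) ⊎ RankBelow b (vertex j)

    facts-distinct : ∀ {i j} → i < len → j < len → fact i ≡ fact j → i ≡ j
    facts-distinct {i} {j} i<len j<len e
      with links-same-fact (link i<len) (subst (λ f → Links T f (vertex j) (vertex (suc j))) (sym e) (link j<len))
    ... | inj₁ (same , _)  = distinct (<⇒≤ i<len) (<⇒≤ j<len) same
    ... | inj₂ (i~1+j , 1+i~j) =
      contradiction (≤-reflexive (distinct i<len (<⇒≤ j<len) 1+i~j))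
                    (<-asym (≤-reflexive (sym (distinct (<⇒≤ i<len) j<len i~1+j))))

  -- Facts of a path are only meaningful below its length; elsewhere a default fact is used.
  module _ (default : Fact T) where

    trivial-path : ∀ u → TreePath u u
    trivial-path u = record
      { len = 0 ; vertex = λ _ → u ; fact = λ _ → default ; starts = refl ; ends = refl
      ; link = λ () ; parental = λ () ; distinct = λ { z≤n z≤n _ → refl } ; near-ends = λ _ → inj₁ (inj₁ refl) }

    cons-path : ∀ {u y v g} → parent u ≡ just (y , g) → TreePath y v → rank v ≤ rank u → u ≢ v → TreePath u v
    cons-path {u} {y} {v} {g} pu P v≤u u≢v = record
      { len = suc len ; vertex = vertex′ ; fact = fact′ ; starts = refl ; ends = ends
      ; link = λ { {zero} _ → subst (Links T g u) (sym starts) (parent-links pu)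
                 ; {suc j} j<len → link (s≤s⁻¹ j<len) }
      ; parental = λ { {zero} _ → u , y , pu ; {suc j} j<len → parental (s≤s⁻¹ j<len) }
      ; distinct = distinct′ ; near-ends = near-ends′ }
      where
      open TreePath P
      vertex′ : ℕ → V
      vertex′ zero    = u
      vertex′ (suc j) = vertex j
      fact′ : ℕ → Fact T
      fact′ zero    = g
      fact′ (suc j) = fact j
      y<u : rank y < rank u
      y<u = ≤-reflexive (parent-rank pu)
      fresh : ∀ {j} → j ≤ len → vertex j ≢ u
      fresh j≤len e with near-ends j≤len
      ... | inj₁ (inj₁ q) = <-irrefl (cong rank (trans (sym q) e)) y<u
      ... | inj₁ (inj₂ q) = <-asym y<u (subst (λ z → rank z < rank y) e q)
      ... | inj₂ (inj₁ q) = u≢v (trans (sym e) q)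
      ... | inj₂ (inj₂ q) = <-irrefl refl (<-≤-trans (subst (λ z → rank z < rank v) e q) v≤u)
      distinct′ : ∀ {i j} → i ≤ suc len → j ≤ suc len → vertex′ i ≡ vertex′ j → i ≡ j
      distinct′ {zero}  {zero}  _         _         _ = refl
      distinct′ {zero}  {suc j} _         (s≤s j≤) e = contradiction (sym e) (fresh j≤)
      distinct′ {suc i} {zero}  (s≤s i≤) _         e = contradiction e (fresh i≤)
      distinct′ {suc i} {suc j} (s≤s i≤) (s≤s j≤) e = cong suc (distinct i≤ j≤ e)
      near-ends′ : ∀ {j} → j ≤ suc len → RankBelow u (vertex′ j) ⊎ RankBelow v (vertex′ j)
      near-ends′ {zero}  _        = inj₁ (inj₁ refl)
      near-ends′ {suc j} (s≤s j≤) with near-ends j≤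
      ... | inj₁ (inj₁ q) = inj₁ (inj₂ (subst (λ z → rank z < rank u) (sym q) y<u))
      ... | inj₁ (inj₂ q) = inj₁ (inj₂ (<-trans q y<u))
      ... | inj₂ q        = inj₂ q

    snoc-path : ∀ {u y v g} → TreePath u y → parent v ≡ just (y , g) → rank u < rank v → u ≢ v → TreePath u v
    snoc-path {u} {y} {v} {g} P pv u<v u≢v = record
      { len = suc len ; vertex = vertex [ suc len ↦ v ] ; fact = fact [ len ↦ g ]
      ; starts = trans (↦-miss vertex {m = suc len} {a = v} 0≢1+n) starts ; ends = ↦-hit vertex (suc len) v
      ; link = links-extend link (subst (λ z → Links T g z v) (sym ends) (links-sym (parent-links pv)))
      ; parental = ↦-pointwise fact {P = λ _ f → ∃₂ λ z w → parent z ≡ just (w , f)} parental (v , y , pv)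
      ; distinct = ↦-injective vertex (λ i< j< → distinct (s≤s⁻¹ i<) (s≤s⁻¹ j<)) (λ j< → fresh (s≤s⁻¹ j<))
      ; near-ends = λ j≤ → ↦-pointwise vertex {P = λ _ x → RankBelow u x ⊎ RankBelow v x}
                             (λ j< → widen (near-ends (s≤s⁻¹ j<))) (inj₂ (inj₁ refl)) (s≤s j≤) }
      where
      open TreePath P
      y<v : rank y < rank v
      y<v = ≤-reflexive (parent-rank pv)
      fresh : ∀ {j} → j ≤ len → vertex j ≢ v
      fresh j≤len e with near-ends j≤len
      ... | inj₁ (inj₁ q) = u≢v (trans (sym q) e)
      ... | inj₁ (inj₂ q) = <-asym u<v (subst (λ z → rank z < rank u) e q)
      ... | inj₂ (inj₁ q) = <-irrefl (cong rank (trans (sym q) e)) y<v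
      ... | inj₂ (inj₂ q) = <-asym y<v (subst (λ z → rank z < rank y) e q)
      widen : ∀ {x} → RankBelow u x ⊎ RankBelow y x → RankBelow u x ⊎ RankBelow v x
      widen (inj₁ q)        = inj₁ q
      widen (inj₂ (inj₁ q)) = inj₂ (inj₂ (subst (λ z → rank z < rank v) (sym q) y<v))
      widen (inj₂ (inj₂ q)) = inj₂ (inj₂ (<-trans q y<v))

    tree-path : ∀ u v → TreePath u v
    tree-path u v = go (suc (rank u + rank v)) u v ≤-refl
      where
      go : ∀ F u v → rank u + rank v < F → TreePath u v
      go (suc F) u v (s≤s bound) with u Fin.≟ v
      ... | yes refl = trivial-path u
      ... | no u≢v with rank v ℕ.≤? rank u
      ...   | yes v≤u =
        let (y , g , pu) = non-root-parent u≢root in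
        cons-path pu (go F y v (subst (λ r → r + rank v ≤ F) (sym (parent-rank pu)) bound)) v≤u u≢v
        where
        u≢root : u ≢ root T
        u≢root refl = u≢v (sym (rank-zero-root (n≤0⇒n≡0 (subst (rank v ≤_) rank-root v≤u))))
      ...   | no v≰u =
        let (y , g , pv) = non-root-parent v≢root in
        snoc-path (go F u y (subst (_≤ F) (trans (cong (rank u +_) (sym (parent-rank pv))) (+-suc (rank u) (rank y)))
                                    bound))
                  pv (≰⇒> v≰u) u≢v
        where
        v≢root : v ≢ root T
        v≢root refl = v≰u (subst (_≤ rank u) (sym rank-root) z≤n)

  closing-cycle : ∀ {i u v} → IsFact T (i , u , v) → (∀ {z y} → parent z ≢ just (y , (i , u , v))) →
                  TreePath u v → Cycle T
  closing-cycle {i} {u} {v} isf orphan P = record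
    { len = len
    ; vert = vertex′ ∘ toℕ
    ; closes = trans (cong vertex′ (toℕ-fromℕ (suc len)))
                     (trans (↦-hit vertex (suc len) u)
                            (sym (trans (↦-miss vertex {m = suc len} {a = u} 0≢1+n) starts)))
    ; edge = fact′ ∘ toℕ
    ; links = λ j → subst (λ k → Links T (fact′ (toℕ j)) (vertex′ k) (vertex′ (suc (toℕ j)))) (sym (toℕ-inject₁ j))
                          (links-extend link closing-link (toℕ<n j))
    ; vinj = λ {a} {b} e → toℕ-injective (distinct (s≤s⁻¹ (toℕ<n a)) (s≤s⁻¹ (toℕ<n b))
                                           (trans (sym (vertex′-inject₁ a)) (trans e (vertex′-inject₁ b))))
    ; einj = λ {a} {b} → toℕ-injective ∘ ↦-injective fact facts-distinct fresh (s≤s⁻¹ (toℕ<n a)) (s≤s⁻¹ (toℕ<n b))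
    }
    where
    open TreePath P
    f : Fact T
    f = i , u , v
    vertex′ : ℕ → V
    vertex′ = vertex [ suc len ↦ u ]
    fact′ : ℕ → Fact T
    fact′ = fact [ len ↦ f ]
    closing-link : Links T f (vertex len) u
    closing-link = subst (λ z → Links T f z u) (sym ends) (isf , inj₂ (refl , refl))
    vertex′-inject₁ : ∀ (a : Fin (suc len)) → vertex′ (toℕ (inject₁ a)) ≡ vertex (toℕ a)
    vertex′-inject₁ a = trans (cong vertex′ (toℕ-inject₁ a)) (↦-miss vertex (<⇒≢ (toℕ<n a)))
    fresh : ∀ {j} → j < len → fact j ≢ f
    fresh j<len e with parental j<len
    ... | z , y , q = orphan (trans q (cong (λ g → just (y , g)) e))

  _≟-parent_ : (m m′ : Maybe (V × Fact T)) → Dec (m ≡ m′)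
  _≟-parent_ = Maybe.≡-dec (Product.≡-dec Fin._≟_ (Product.≡-dec Fin._≟_ (Product.≡-dec Fin._≟_ Fin._≟_)))

  acyclic⇒covering : Acyclic T → CoversFacts
  acyclic⇒covering acyclic {i} {u} {v} isf
    with parent v ≟-parent just (u , (i , u , v)) | parent u ≟-parent just (v , (i , u , v))
  ... | yes q | _     = inj₁ q
  ... | no _  | yes q = inj₂ q
  ... | no ¬v | no ¬u = contradiction (closing-cycle isf orphan (tree-path (i , u , v) u v)) acyclic
    where
    orphan : ∀ {z y} → parent z ≢ just (y , (i , u , v))
    orphan q with parent-links q
    ... | _ , inj₁ (refl , refl) = ¬u q
    ... | _ , inj₂ (refl , refl) = ¬v q

  covering-∈𝒜 : ∀ {k} → CoversFacts → (∀ x → rank x ≤ k) → InA k T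
  covering-∈𝒜 covers bounded =
    (λ x → rank x , walk-from-root x) , covering⇒acyclic covers , (λ x → rank x , bounded x , walk-from-root x)

data Dir : Set where
  fwd bwd : Dir

_≟-dir_ : DecidableEquality Dir
fwd ≟-dir fwd = yes refl
fwd ≟-dir bwd = no λ ()
bwd ≟-dir fwd = no λ ()
bwd ≟-dir bwd = yes refl

Step : (M : LTS p n) → Fin n → Dir → State M → State M → Set
Step M i fwd s t = rel M i s t
Step M i bwd s t = rel M i t s

arrow : (T : FinLTS p n) → Fin n → Dir → Fin (size T) → Fin (size T) → Bool
arrow T i fwd x y = frel T i x y
arrow T i bwd x y = frel T i y x

oriented : ∀ {A : Set} → Fin n → Dir → A → A → Fin n × A × A
oriented i fwd y x = i , y , x
oriented i bwd y x = i , x , y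

arrow-links : ∀ {T : FinLTS p n} {i} d {x y} → arrow T i d y x ≡ true → Links T (oriented i d y x) x y
arrow-links fwd a = a , inj₂ (refl , refl)
arrow-links bwd a = a , inj₁ (refl , refl)

hom-arrow : ∀ {T : FinLTS p n} {M} (H : Hom T M) {i} d {x y} →
            arrow T i d x y ≡ true → Step M i d (Hom.map H x) (Hom.map H y)
hom-arrow H fwd = Hom.pres-rel H _ _ _
hom-arrow H bwd = Hom.pres-rel H _ _ _

from-does : ∀ {A : Set} (a? : Dec A) → does a? ≡ true → A
from-does (yes a) _  = a
from-does (no _)  ()

-- Conjunctive formulas and their trees

data Conj (p n : ℕ) : Set where
  ⊤ᶜ    : Conj p n
  atomᶜ : Fin p → Conj p n
  _∧ᶜ_  : Conj p n → Conj p n → Conj p n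
  ◇ᶜ    : Fin n → Dir → Conj p n → Conj p n

depthᶜ : Conj p n → ℕ
depthᶜ ⊤ᶜ         = 0
depthᶜ (atomᶜ _)  = 0
depthᶜ (a ∧ᶜ b)   = depthᶜ a ⊔ depthᶜ b
depthᶜ (◇ᶜ _ _ a) = suc (depthᶜ a)

_⊨ᶜ_at_ : (M : LTS p n) → Conj p n → State M → Set
M ⊨ᶜ ⊤ᶜ at s       = ⊤
M ⊨ᶜ atomᶜ j at s  = prop M j s
M ⊨ᶜ (a ∧ᶜ b) at s = (M ⊨ᶜ a at s) × (M ⊨ᶜ b at s)
M ⊨ᶜ ◇ᶜ i d a at s = ∃[ t ] (Step M i d s t × M ⊨ᶜ a at t)

-- A proof of M ⊨ φ at s picks one disjunct of the disjunctive normal form of φ.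
disjunct : ∀ (φ : Form p n) {M s} → M ⊨ φ at s → Conj p n
disjunct tt         _           = ⊤ᶜ
disjunct (var j)    _           = atomᶜ j
disjunct (φ ∧ ψ)    (u , v)     = disjunct φ u ∧ᶜ disjunct ψ v
disjunct (φ ∨ ψ)    (inj₁ u)    = disjunct φ u
disjunct (φ ∨ ψ)    (inj₂ v)    = disjunct ψ v
disjunct (dia i φ)  (_ , _ , u) = ◇ᶜ i fwd (disjunct φ u)
disjunct (bdia i φ) (_ , _ , u) = ◇ᶜ i bwd (disjunct φ u)

module _ {M : LTS p n} where

  disjunct-holds : ∀ φ {s} (w : M ⊨ φ at s) → M ⊨ᶜ disjunct φ w at s
  disjunct-holds tt         _           = tt
  disjunct-holds (var j)    w           = w
  disjunct-holds (φ ∧ ψ)    (u , v)     = disjunct-holds φ u , disjunct-holds ψ v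
  disjunct-holds (φ ∨ ψ)    (inj₁ u)    = disjunct-holds φ u
  disjunct-holds (φ ∨ ψ)    (inj₂ v)    = disjunct-holds ψ v
  disjunct-holds (dia i φ)  (t , r , u) = t , r , disjunct-holds φ u
  disjunct-holds (bdia i φ) (t , r , u) = t , r , disjunct-holds φ u

  disjunct-entails : ∀ {N : LTS p n} φ {s t} (w : M ⊨ φ at s) → N ⊨ᶜ disjunct φ w at t → N ⊨ φ at t
  disjunct-entails tt         _           _           = tt
  disjunct-entails (var j)    _           v           = v
  disjunct-entails (φ ∧ ψ)    (u , u′)    (v , v′)    = disjunct-entails φ u v , disjunct-entails ψ u′ v′
  disjunct-entails (φ ∨ ψ)    (inj₁ u)    v           = inj₁ (disjunct-entails φ u v)
  disjunct-entails (φ ∨ ψ)    (inj₂ u)    v           = inj₂ (disjunct-entails ψ u v)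
  disjunct-entails (dia i φ)  (_ , _ , u) (t , r , v) = t , r , disjunct-entails φ u v
  disjunct-entails (bdia i φ) (_ , _ , u) (t , r , v) = t , r , disjunct-entails φ u v

  depthᶜ-disjunct : ∀ φ {s} (w : M ⊨ φ at s) → depthᶜ (disjunct φ w) ≤ md φ
  depthᶜ-disjunct tt         _           = z≤n
  depthᶜ-disjunct (var j)    _           = z≤n
  depthᶜ-disjunct (φ ∧ ψ)    (u , v)     = ⊔-mono-≤ (depthᶜ-disjunct φ u) (depthᶜ-disjunct ψ v)
  depthᶜ-disjunct (φ ∨ ψ)    (inj₁ u)    = m≤n⇒m≤n⊔o (md ψ) (depthᶜ-disjunct φ u)
  depthᶜ-disjunct (φ ∨ ψ)    (inj₂ v)    = m≤n⇒m≤o⊔n (md φ) (depthᶜ-disjunct ψ v)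
  depthᶜ-disjunct (dia i φ)  (_ , _ , u) = s≤s (depthᶜ-disjunct φ u)
  depthᶜ-disjunct (bdia i φ) (_ , _ , u) = s≤s (depthᶜ-disjunct φ u)

-- The tree of c: its root is nothing, and the non-root nodes are the branches of c.
Branch : Conj p n → Set
Node : Conj p n → Set
Node c = Maybe (Branch c)
Branch ⊤ᶜ         = ⊥
Branch (atomᶜ _)  = ⊥
Branch (a ∧ᶜ b)   = Branch a ⊎ Branch b
Branch (◇ᶜ _ _ a) = Node a

#branches : Conj p n → ℕ
#branches ⊤ᶜ         = 0
#branches (atomᶜ _)  = 0
#branches (a ∧ᶜ b)   = #branches a + #branches b
#branches (◇ᶜ _ _ a) = suc (#branches a)

encodeᴮ : ∀ (c : Conj p n) → Branch c → Fin (#branches c)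
encode  : ∀ (c : Conj p n) → Node c → Fin (suc (#branches c))
encodeᴮ (a ∧ᶜ b)   (inj₁ x) = encodeᴮ a x ↑ˡ #branches b
encodeᴮ (a ∧ᶜ b)   (inj₂ y) = #branches a ↑ʳ encodeᴮ b y
encodeᴮ (◇ᶜ _ _ a) x        = encode a x
encode c nothing  = fzero
encode c (just x) = fsuc (encodeᴮ c x)

decodeᴮ : ∀ (c : Conj p n) → Fin (#branches c) → Branch c
decode  : ∀ (c : Conj p n) → Fin (suc (#branches c)) → Node c
decodeᴮ (a ∧ᶜ b)   k = [ inj₁ ∘ decodeᴮ a , inj₂ ∘ decodeᴮ b ] (splitAt (#branches a) k)
decodeᴮ (◇ᶜ _ _ a) k = decode a k
decode c fzero    = nothing
decode c (fsuc k) = just (decodeᴮ c k)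

decode-encodeᴮ : ∀ (c : Conj p n) x → decodeᴮ c (encodeᴮ c x) ≡ x
decode-encode  : ∀ (c : Conj p n) x → decode c (encode c x) ≡ x
decode-encodeᴮ (a ∧ᶜ b) (inj₁ x)
  rewrite splitAt-↑ˡ (#branches a) (encodeᴮ a x) (#branches b) = cong inj₁ (decode-encodeᴮ a x)
decode-encodeᴮ (a ∧ᶜ b) (inj₂ y)
  rewrite splitAt-↑ʳ (#branches a) (#branches b) (encodeᴮ b y) = cong inj₂ (decode-encodeᴮ b y)
decode-encodeᴮ (◇ᶜ _ _ a) x = decode-encode a x
decode-encode c nothing  = refl
decode-encode c (just x) = cong just (decode-encodeᴮ c x)

encode-decodeᴮ : ∀ (c : Conj p n) k → encodeᴮ c (decodeᴮ c k) ≡ k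
encode-decode  : ∀ (c : Conj p n) k → encode c (decode c k) ≡ k
encode-decodeᴮ (a ∧ᶜ b) k = trans (lemma (splitAt (#branches a) k)) (join-splitAt (#branches a) (#branches b) k)
  where
  lemma : ∀ s → encodeᴮ (a ∧ᶜ b) ([ inj₁ ∘ decodeᴮ a , inj₂ ∘ decodeᴮ b ] s) ≡ join (#branches a) (#branches b) s
  lemma (inj₁ x) = cong (_↑ˡ #branches b) (encode-decodeᴮ a x)
  lemma (inj₂ y) = cong (#branches a ↑ʳ_) (encode-decodeᴮ b y)
encode-decodeᴮ (◇ᶜ _ _ a) k = encode-decode a k
encode-decode c fzero    = refl
encode-decode c (fsuc k) = cong fsuc (encode-decodeᴮ c k)

_≟-node_ : ∀ {c : Conj p n} → DecidableEquality (Node c)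
_≟-node_ {c = c} x y =
  map′ (λ e → trans (sym (decode-encode c x)) (trans (cong (decode c) e) (decode-encode c y))) (cong (encode c))
       (encode c x Fin.≟ encode c y)

Labelled : ∀ (c : Conj p n) → Fin p → Node c → Set
Labelled ⊤ᶜ         j _                = ⊥
Labelled (atomᶜ q)  j nothing          = j ≡ q
Labelled (a ∧ᶜ b)   j nothing          = Labelled a j nothing ⊎ Labelled b j nothing
Labelled (a ∧ᶜ b)   j (just (inj₁ x)) = Labelled a j (just x)
Labelled (a ∧ᶜ b)   j (just (inj₂ y)) = Labelled b j (just y)
Labelled (◇ᶜ _ _ a) j nothing          = ⊥
Labelled (◇ᶜ _ _ a) j (just x)         = Labelled a j x

labelled? : ∀ (c : Conj p n) j x → Dec (Labelled c j x)
labelled? ⊤ᶜ         j _                = no λ ()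
labelled? (atomᶜ q)  j nothing          = j Fin.≟ q
labelled? (a ∧ᶜ b)   j nothing          = labelled? a j nothing ⊎-dec labelled? b j nothing
labelled? (a ∧ᶜ b)   j (just (inj₁ x)) = labelled? a j (just x)
labelled? (a ∧ᶜ b)   j (just (inj₂ y)) = labelled? b j (just y)
labelled? (◇ᶜ _ _ a) j nothing          = no λ ()
labelled? (◇ᶜ _ _ a) j (just x)         = labelled? a j x

lift-parent : ∀ {A B : Set} → (A → B) → Maybe (Fin n × Dir × A) → Maybe (Fin n × Dir × B)
lift-parent g nothing            = nothing
lift-parent g (just (i , d , x)) = just (i , d , g x)

-- parentᶜ c x = just (i , d , y): x is reached from y by a d-step along R_i.
parentᶜ : ∀ (c : Conj p n) → Node c → Maybe (Fin n × Dir × Node c)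
parentᶜ c          nothing          = nothing
parentᶜ (a ∧ᶜ b)   (just (inj₁ x)) = lift-parent (Maybe.map inj₁) (parentᶜ a (just x))
parentᶜ (a ∧ᶜ b)   (just (inj₂ y)) = lift-parent (Maybe.map inj₂) (parentᶜ b (just y))
parentᶜ (◇ᶜ i d a) (just nothing)   = just (i , d , nothing)
parentᶜ (◇ᶜ i d a) (just (just x))  = lift-parent just (parentᶜ a (just x))

height : ∀ (c : Conj p n) → Node c → ℕ
height c          nothing          = 0
height (a ∧ᶜ b)   (just (inj₁ x)) = height a (just x)
height (a ∧ᶜ b)   (just (inj₂ y)) = height b (just y)
height (◇ᶜ _ _ a) (just x)         = suc (height a x)

height-≤-depthᶜ : ∀ (c : Conj p n) x → height c x ≤ depthᶜ c
height-≤-depthᶜ c          nothing          = z≤n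
height-≤-depthᶜ (a ∧ᶜ b)   (just (inj₁ x)) = m≤n⇒m≤n⊔o (depthᶜ b) (height-≤-depthᶜ a (just x))
height-≤-depthᶜ (a ∧ᶜ b)   (just (inj₂ y)) = m≤n⇒m≤o⊔n (depthᶜ a) (height-≤-depthᶜ b (just y))
height-≤-depthᶜ (◇ᶜ _ _ a) (just x)         = s≤s (height-≤-depthᶜ a x)

module _ {a b : Conj p n} where

  height-∧ˡ : ∀ x → height (a ∧ᶜ b) (Maybe.map inj₁ x) ≡ height a x
  height-∧ˡ nothing  = refl
  height-∧ˡ (just _) = refl

  height-∧ʳ : ∀ y → height (a ∧ᶜ b) (Maybe.map inj₂ y) ≡ height b y
  height-∧ʳ nothing  = refl
  height-∧ʳ (just _) = refl

  parentᶜ-∧ˡ : ∀ x {i d y} → parentᶜ a x ≡ just (i , d , y) →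
               parentᶜ (a ∧ᶜ b) (Maybe.map inj₁ x) ≡ just (i , d , Maybe.map inj₁ y)
  parentᶜ-∧ˡ (just x) q = cong (lift-parent _) q

  parentᶜ-∧ʳ : ∀ x {i d y} → parentᶜ b x ≡ just (i , d , y) →
               parentᶜ (a ∧ᶜ b) (Maybe.map inj₂ x) ≡ just (i , d , Maybe.map inj₂ y)
  parentᶜ-∧ʳ (just x) q = cong (lift-parent _) q

  labelled-∧ˡ : ∀ {j} x → Labelled a j x → Labelled (a ∧ᶜ b) j (Maybe.map inj₁ x)
  labelled-∧ˡ nothing  = inj₁
  labelled-∧ˡ (just _) l = l

  labelled-∧ʳ : ∀ {j} x → Labelled b j x → Labelled (a ∧ᶜ b) j (Maybe.map inj₂ x)
  labelled-∧ʳ nothing  = inj₂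
  labelled-∧ʳ (just _) l = l

parentᶜ-◇ : ∀ {a : Conj p n} {k e} x {i d y} → parentᶜ a x ≡ just (i , d , y) →
            parentᶜ (◇ᶜ k e a) (just x) ≡ just (i , d , just y)
parentᶜ-◇ (just x) q = cong (lift-parent just) q

parentᶜ-height : ∀ (c : Conj p n) {x i d y} → parentᶜ c x ≡ just (i , d , y) → suc (height c y) ≡ height c x
parentᶜ-height (a ∧ᶜ b) {just (inj₁ x)} q with parentᶜ a (just x) in e
parentᶜ-height (a ∧ᶜ b) {just (inj₁ x)} refl | just (_ , _ , y) =
  trans (cong suc (height-∧ˡ y)) (parentᶜ-height a {just x} e)
parentᶜ-height (a ∧ᶜ b) {just (inj₂ x)} q with parentᶜ b (just x) in e
parentᶜ-height (a ∧ᶜ b) {just (inj₂ x)} refl | just (_ , _ , y) =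
  trans (cong suc (height-∧ʳ y)) (parentᶜ-height b {just x} e)
parentᶜ-height (◇ᶜ _ _ a) {just nothing} refl = refl
parentᶜ-height (◇ᶜ _ _ a) {just (just x)} q with parentᶜ a (just x) in e
parentᶜ-height (◇ᶜ _ _ a) {just (just x)} refl | just _ = cong suc (parentᶜ-height a {just x} e)

branch-has-parentᶜ : ∀ (c : Conj p n) x → parentᶜ c (just x) ≢ nothing
branch-has-parentᶜ (a ∧ᶜ b) (inj₁ x) with parentᶜ a (just x) in e
... | nothing = λ _ → branch-has-parentᶜ a x e
branch-has-parentᶜ (a ∧ᶜ b) (inj₂ y) with parentᶜ b (just y) in e
... | nothing = λ _ → branch-has-parentᶜ b y e
branch-has-parentᶜ (◇ᶜ _ _ a) nothing = λ ()
branch-has-parentᶜ (◇ᶜ _ _ a) (just x) with parentᶜ a (just x) in e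
... | nothing = λ _ → branch-has-parentᶜ a x e

record TreeHom (c : Conj p n) (M : LTS p n) (s : State M) : Set where
  field
    map        : Node c → State M
    map-root   : map nothing ≡ s
    map-label  : ∀ {j x} → Labelled c j x → prop M j (map x)
    map-parent : ∀ {x i d y} → parentᶜ c x ≡ just (i , d , y) → Step M i d (map y) (map x)

module _ {M : LTS p n} where

  ⊨ᶜ⇒TreeHom : ∀ c {s} → M ⊨ᶜ c at s → TreeHom c M s
  ⊨ᶜ⇒TreeHom ⊤ᶜ {s} _ = record
    { map = λ _ → s ; map-root = refl ; map-label = λ () ; map-parent = λ { {nothing} () } }
  ⊨ᶜ⇒TreeHom (atomᶜ q) {s} w = record
    { map = λ _ → s ; map-root = refl ; map-label = λ { {x = nothing} refl → w } ; map-parent = λ { {nothing} () } }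
  ⊨ᶜ⇒TreeHom (a ∧ᶜ b) {s} (u , v) = record
    { map = map ; map-root = refl ; map-label = λ {j} {x} → map-label {j} {x} ; map-parent = λ {x} → map-parent {x} }
    where
    module A = TreeHom (⊨ᶜ⇒TreeHom a u)
    module B = TreeHom (⊨ᶜ⇒TreeHom b v)
    map : Node (a ∧ᶜ b) → State M
    map nothing          = s
    map (just (inj₁ x)) = A.map (just x)
    map (just (inj₂ y)) = B.map (just y)
    map-∧ˡ : ∀ x → map (Maybe.map inj₁ x) ≡ A.map x
    map-∧ˡ nothing  = sym A.map-root
    map-∧ˡ (just _) = refl
    map-∧ʳ : ∀ y → map (Maybe.map inj₂ y) ≡ B.map y
    map-∧ʳ nothing  = sym B.map-root
    map-∧ʳ (just _) = refl
    map-label : ∀ {j x} → Labelled (a ∧ᶜ b) j x → prop M j (map x)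
    map-label {j} {nothing} (inj₁ l) = subst (prop M j) A.map-root (A.map-label l)
    map-label {j} {nothing} (inj₂ l) = subst (prop M j) B.map-root (B.map-label l)
    map-label {x = just (inj₁ x)} l  = A.map-label l
    map-label {x = just (inj₂ y)} l  = B.map-label l
    map-parent : ∀ {x i d y} → parentᶜ (a ∧ᶜ b) x ≡ just (i , d , y) → Step M i d (map y) (map x)
    map-parent {just (inj₁ x)} q with parentᶜ a (just x) in e
    map-parent {just (inj₁ x)} refl | just (i , d , y) =
      subst (λ t → Step M i d t _) (sym (map-∧ˡ y)) (A.map-parent e)
    map-parent {just (inj₂ x)} q with parentᶜ b (just x) in e
    map-parent {just (inj₂ x)} refl | just (i , d , y) =
      subst (λ t → Step M i d t _) (sym (map-∧ʳ y)) (B.map-parent e)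
  ⊨ᶜ⇒TreeHom (◇ᶜ i d a) {s} (t , st , w) = record
    { map = map ; map-root = refl ; map-label = λ {j} {x} → map-label {j} {x} ; map-parent = λ {x} → map-parent {x} }
    where
    module A = TreeHom (⊨ᶜ⇒TreeHom a w)
    map : Node (◇ᶜ i d a) → State M
    map nothing  = s
    map (just x) = A.map x
    map-label : ∀ {j x} → Labelled (◇ᶜ i d a) j x → prop M j (map x)
    map-label {x = just x} = A.map-label
    map-parent : ∀ {x k e y} → parentᶜ (◇ᶜ i d a) x ≡ just (k , e , y) → Step M k e (map y) (map x)
    map-parent {just nothing} refl = subst (Step M i d s) (sym A.map-root) st
    map-parent {just (just x)} q with parentᶜ a (just x) in e
    map-parent {just (just x)} refl | just _ = A.map-parent e

  TreeHom⇒⊨ᶜ : ∀ c {s} → TreeHom c M s → M ⊨ᶜ c at s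
  TreeHom⇒⊨ᶜ ⊤ᶜ        _ = tt
  TreeHom⇒⊨ᶜ (atomᶜ q) H = subst (prop M q) map-root (map-label {x = nothing} refl)
    where open TreeHom H
  TreeHom⇒⊨ᶜ (a ∧ᶜ b)  H = TreeHom⇒⊨ᶜ a restrictˡ , TreeHom⇒⊨ᶜ b restrictʳ
    where
    open TreeHom H
    restrictˡ : TreeHom a M _
    restrictˡ = record
      { map = map ∘ Maybe.map inj₁ ; map-root = map-root
      ; map-label = λ {_} {x} → map-label ∘ labelled-∧ˡ x ; map-parent = λ {x} → map-parent ∘ parentᶜ-∧ˡ x }
    restrictʳ : TreeHom b M _
    restrictʳ = record
      { map = map ∘ Maybe.map inj₂ ; map-root = map-root
      ; map-label = λ {_} {x} → map-label ∘ labelled-∧ʳ x ; map-parent = λ {x} → map-parent ∘ parentᶜ-∧ʳ x }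
  TreeHom⇒⊨ᶜ (◇ᶜ i d a) H =
    map (just nothing) , subst (λ t → Step M i d t _) map-root (map-parent {just nothing} refl) , TreeHom⇒⊨ᶜ a subtree
    where
    open TreeHom H
    subtree : TreeHom a M (map (just nothing))
    subtree = record
      { map = map ∘ just ; map-root = refl ; map-label = map-label ; map-parent = λ {x} → map-parent ∘ parentᶜ-◇ x }

TreeEdge : ∀ (c : Conj p n) → Fin n → Node c → Node c → Set
TreeEdge c i x y = parentᶜ c y ≡ just (i , fwd , x) ⊎ parentᶜ c x ≡ just (i , bwd , y)

tree-edge? : ∀ (c : Conj p n) i x y → Dec (TreeEdge c i x y)
tree-edge? c i x y = parentᶜ c y ≟ just (i , fwd , x) ⊎-dec parentᶜ c x ≟ just (i , bwd , y)
  where _≟_ = Maybe.≡-dec (Product.≡-dec Fin._≟_ (Product.≡-dec _≟-dir_ _≟-node_))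

tree : Conj p n → FinLTS p n
tree c = record
  { size  = suc (#branches c)
  ; fprop = λ j k → does (labelled? c j (decode c k))
  ; frel  = λ i k l → does (tree-edge? c i (decode c k) (decode c l))
  ; root  = fzero }

arrow-of-parentᶜ : ∀ (c : Conj p n) {x i d y} → parentᶜ c x ≡ just (i , d , y) →
                   arrow (tree c) i d (encode c y) (encode c x) ≡ true
arrow-of-parentᶜ c {x} {i} {fwd} {y} q rewrite decode-encode c x | decode-encode c y =
  dec-true (tree-edge? c i y x) (inj₁ q)
arrow-of-parentᶜ c {x} {i} {bwd} {y} q rewrite decode-encode c x | decode-encode c y =
  dec-true (tree-edge? c i x y) (inj₂ q)

module _ {c : Conj p n} {M : LTS p n} where

  Hom⇒TreeHom : Hom (tree c) M → TreeHom c M (point M)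
  Hom⇒TreeHom H = record
    { map        = map ∘ encode c
    ; map-root   = pres-pt
    ; map-label  = λ {j} {x} l → pres-prop j (encode c x)
                                   (dec-true (labelled? c j _) (subst (Labelled c j) (sym (decode-encode c x)) l))
    ; map-parent = λ {x} {i} {d} q → hom-arrow H d (arrow-of-parentᶜ c q) }
    where open Hom H

  TreeHom⇒Hom : TreeHom c M (point M) → Hom (tree c) M
  TreeHom⇒Hom H = record
    { map       = map ∘ decode c
    ; pres-prop = λ j k e → map-label (from-does (labelled? c j _) e)
    ; pres-rel  = pres-rel
    ; pres-pt   = map-root }
    where
    open TreeHom H
    pres-rel : ∀ i k l → frel (tree c) i k l ≡ true → rel M i (map (decode c k)) (map (decode c l))
    pres-rel i k l e with from-does (tree-edge? c i (decode c k) (decode c l)) e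
    ... | inj₁ q = map-parent q
    ... | inj₂ q = map-parent q

tree-parentMap : ∀ (c : Conj p n) → ParentMap (tree c)
tree-parentMap c = record
  { rank         = height c ∘ decode c
  ; parent       = λ k → lift k (parentᶜ c (decode c k))
  ; parent-links = λ {k} → parent-links k
  ; parent-rank  = λ {k} → parent-rank k
  ; orphan-root  = λ {k} → orphan-root k
  ; rank-root    = refl }
  where
  V = Fin (suc (#branches c))
  lift : V → Maybe (Fin _ × Dir × Node c) → Maybe (V × Fact (tree c))
  lift k nothing            = nothing
  lift k (just (i , d , y)) = just (encode c y , oriented i d (encode c y) k)
  parent-links : ∀ k {l f} → lift k (parentᶜ c (decode c k)) ≡ just (l , f) → Links (tree c) f k l
  parent-links k q with parentᶜ c (decode c k) in e
  parent-links k refl | just (i , d , y) =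
    arrow-links d (subst (λ z → arrow (tree c) i d (encode c y) z ≡ true) (encode-decode c k) (arrow-of-parentᶜ c e))
  parent-rank : ∀ k {l f} → lift k (parentᶜ c (decode c k)) ≡ just (l , f) →
                suc (height c (decode c l)) ≡ height c (decode c k)
  parent-rank k q with parentᶜ c (decode c k) in e
  parent-rank k refl | just (i , d , y) rewrite decode-encode c y = parentᶜ-height c {decode c k} e
  orphan-root : ∀ k → lift k (parentᶜ c (decode c k)) ≡ nothing → k ≡ fzero
  orphan-root fzero    _ = refl
  orphan-root (fsuc k) q with parentᶜ c (just (decodeᴮ c k)) in e
  ... | nothing = contradiction e (branch-has-parentᶜ c (decodeᴮ c k))

tree-covers : ∀ (c : Conj p n) → ParentMap.CoversFacts (tree-parentMap c)
tree-covers c {i} {u} {v} isf with from-does (tree-edge? c i (decode c u) (decode c v)) isf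
... | inj₁ q rewrite q | encode-decode c u = inj₁ refl
... | inj₂ q rewrite q | encode-decode c v = inj₂ refl

tree-∈𝒜 : ∀ {k} (c : Conj p n) → depthᶜ c ≤ k → InA k (tree c)
tree-∈𝒜 c c≤k = ParentMapProperties.covering-∈𝒜 (tree-parentMap c) (tree-covers c)
                  (λ x → ≤-trans (height-≤-depthᶜ c (decode c x)) c≤k)

hom-transfer⇒formula-transfer : ∀ k (M N : LTS p n) → (∀ T → InA k T → Hom T M → Hom T N) →
  ∀ φ → md φ ≤ k → M ⊨ φ at point M → N ⊨ φ at point N
hom-transfer⇒formula-transfer k M N transfer φ φ≤k w =
  disjunct-entails φ w (TreeHom⇒⊨ᶜ c (Hom⇒TreeHom (transfer (tree c) (tree-∈𝒜 c (≤-trans (depthᶜ-disjunct φ w) φ≤k))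
                                                         (TreeHom⇒Hom (⊨ᶜ⇒TreeHom c (disjunct-holds φ w))))))
  where c = disjunct φ w

-- Characteristic formulas

record Least (P : ℕ → Set) : Set where
  field
    value : ℕ
    holds : P value
    least : ∀ {m} → P m → value ≤ m

least : ∀ {P : ℕ → Set} → (∀ m → Dec (P m)) → ∀ {l} → P l → Least P
least {P} P? {l} pl = search 0 l (λ ()) pl
  where
  search : ∀ m r → (∀ {j} → j < m → ¬ P j) → P (m + r) → Least P
  search m r below p with P? m
  ... | yes pm = record { value = m ; holds = pm ; least = λ pj → ≮⇒≥ (λ j<m → below j<m pj) }
  search m zero    below p | no ¬pm = contradiction (subst P (+-identityʳ m) p) ¬pm
  search m (suc r) below p | no ¬pm = search (suc m) r below′ (subst P (+-suc m r) p)
    where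
    below′ : ∀ {j} → j < suc m → ¬ P j
    below′ j<1+m with m≤n⇒m<n∨m≡n (s≤s⁻¹ j<1+m)
    ... | inj₁ j<m  = below j<m
    ... | inj₂ refl = ¬pm

module BreadthFirst {T : FinLTS p n} {k} (shallow : DepthAtMost k T) where
  open WalkProperties T

  private
    V : Set
    V = Fin (size T)

  links? : ∀ f x y → Dec (Links T f x y)
  links? (i , u , v) x y =
    (frel T i u v ≟ᵇ true) ×-dec (((u Fin.≟ x) ×-dec (v Fin.≟ y)) ⊎-dec ((u Fin.≟ y) ×-dec (v Fin.≟ x)))

  walk? : ∀ l x z → Dec (Walk T x z l)
  walk? zero x z with x Fin.≟ z
  ... | yes refl = yes (nil x)
  ... | no x≢z   = no λ { (nil _) → x≢z refl }
  walk? (suc l) x z with any? (λ i → any? (λ u → any? (λ v → any? (λ y → links? (i , u , v) x y ×-dec walk? l y z))))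
  ... | yes (i , u , v , y , lk , w) = yes (step (i , u , v) lk w)
  ... | no ¬w = no λ { (step {y = y} (i , u , v) lk w) → ¬w (i , u , v , y , lk , w) }

  shortest : ∀ x → Least (Walk T (root T) x)
  shortest x = least (λ l → walk? l (root T) x) (proj₂ (proj₂ (shallow x)))

  depth : V → ℕ
  depth x = Least.value (shortest x)

  depth-walk : ∀ x → Walk T (root T) x (depth x)
  depth-walk x = Least.holds (shortest x)

  depth-least : ∀ {x l} → Walk T (root T) x l → depth x ≤ l
  depth-least = Least.least (shortest _)

  depth-≤ : ∀ x → depth x ≤ k
  depth-≤ x = let (_ , l≤k , w) = shallow x in ≤-trans (depth-least w) l≤k

  first-step : ∀ {x z l} → Walk T x z l → Maybe (V × Fact T)
  first-step (nil _)              = nothing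
  first-step (step {y = y} f _ _) = just (y , f)

  first-step-just : ∀ {x y z l f} (w : Walk T x z l) → first-step w ≡ just (y , f) →
                    Links T f x y × ∃[ l′ ] (suc l′ ≡ l × Walk T y z l′)
  first-step-just (step f lk w) refl = lk , _ , refl , w

  first-step-nothing : ∀ {x z l} (w : Walk T x z l) → first-step w ≡ nothing → x ≡ z
  first-step-nothing (nil _) _ = refl

  -- The parent of x is the first vertex on a shortest walk from x back to the root.
  bfs : ParentMap T
  bfs = record
    { rank         = depth
    ; parent       = bfs-parent
    ; parent-links = λ {x} q → proj₁ (first-step-just (walk-reverse (depth-walk x)) q)
    ; parent-rank  = parent-rank
    ; orphan-root  = λ {x} q → first-step-nothing (walk-reverse (depth-walk x)) q
    ; rank-root    = n≤0⇒n≡0 (depth-least (nil _)) }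
    where
    bfs-parent : V → Maybe (V × Fact T)
    bfs-parent x = first-step (walk-reverse (depth-walk x))
    parent-rank : ∀ {x y f} → bfs-parent x ≡ just (y , f) → suc (depth y) ≡ depth x
    parent-rank {x} {y} q with first-step-just (walk-reverse (depth-walk x)) q
    ... | lk , l , 1+l≡dx , w = trans (cong suc (≤-antisym (depth-least (walk-reverse w)) l≤dy)) 1+l≡dx
      where
      l≤dy : l ≤ depth y
      l≤dy = s≤s⁻¹ (subst (_≤ suc (depth y)) (sym 1+l≡dx) (depth-least (walk-snoc (depth-walk y) (links-sym lk))))

⋀ : ∀ {m} → (Fin m → Form p n) → Form p n
⋀ {m = zero}  φ = tt
⋀ {m = suc m} φ = φ fzero ∧ ⋀ (φ ∘ fsuc)

when : Bool → Form p n → Form p n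
when true  φ = φ
when false φ = tt

modal : Dir → Fin n → Form p n → Form p n
modal fwd = dia
modal bwd = bdia

md-⋀ : ∀ {m e} (φ : Fin m → Form p n) → (∀ j → md (φ j) ≤ e) → md (⋀ φ) ≤ e
md-⋀ {m = zero}  φ bound = z≤n
md-⋀ {m = suc m} φ bound = ⊔-lub (bound fzero) (md-⋀ (φ ∘ fsuc) (bound ∘ fsuc))

md-when : ∀ b {e} (φ : Form p n) → md φ ≤ e → md (when b φ) ≤ e
md-when true  φ bound = bound
md-when false φ bound = z≤n

md-modal : ∀ d {i} (φ : Form p n) → md (modal d i φ) ≡ suc (md φ)
md-modal fwd φ = refl
md-modal bwd φ = refl

module _ (M : LTS p n) where

  ⋀-intro : ∀ {m s} (φ : Fin m → Form p n) → (∀ j → M ⊨ φ j at s) → M ⊨ ⋀ φ at s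
  ⋀-intro {m = zero}  φ h = tt
  ⋀-intro {m = suc m} φ h = h fzero , ⋀-intro (φ ∘ fsuc) (h ∘ fsuc)

  ⋀-elim : ∀ {m s} (φ : Fin m → Form p n) → M ⊨ ⋀ φ at s → ∀ j → M ⊨ φ j at s
  ⋀-elim φ (h , _) fzero    = h
  ⋀-elim φ (_ , h) (fsuc j) = ⋀-elim (φ ∘ fsuc) h j

  when-intro : ∀ b {s} (φ : Form p n) → (b ≡ true → M ⊨ φ at s) → M ⊨ when b φ at s
  when-intro true  φ h = h refl
  when-intro false φ h = tt

  when-elim : ∀ {b s} (φ : Form p n) → b ≡ true → M ⊨ when b φ at s → M ⊨ φ at s
  when-elim φ refl h = h

  modal-intro : ∀ d {i s t} {φ : Form p n} → Step M i d s t → M ⊨ φ at t → M ⊨ modal d i φ at s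
  modal-intro fwd st h = _ , st , h
  modal-intro bwd st h = _ , st , h

  modal-elim : ∀ d {i s} {φ : Form p n} → M ⊨ modal d i φ at s → ∃[ t ] (Step M i d s t × M ⊨ φ at t)
  modal-elim fwd h = h
  modal-elim bwd h = h

module Characteristic (T : FinLTS p n) where

  private
    V : Set
    V = Fin (size T)

  labels : V → Form p n
  labels x = ⋀ λ j → when (fprop T j x) (var j)

  -- χ e x describes the unravelling of T from x up to depth e.
  χ      : ℕ → V → Form p n
  χ-edge : ℕ → V → Fin n → Dir → V → Form p n
  χ zero    x = labels x
  χ (suc e) x = labels x ∧ ⋀ (λ i → ⋀ (λ y → χ-edge e x i fwd y ∧ χ-edge e x i bwd y))
  χ-edge e x i d y = when (arrow T i d x y) (modal d i (χ e y))

  md-labels : ∀ x → md (labels x) ≤ 0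
  md-labels x = md-⋀ (λ j → when (fprop T j x) (var j)) λ j → md-when (fprop T j x) (var j) z≤n

  md-χ : ∀ e x → md (χ e x) ≤ e
  md-χ zero    x = md-labels x
  md-χ (suc e) x =
    ⊔-lub (≤-trans (md-labels x) z≤n)
          (md-⋀ (λ i → ⋀ (λ y → χ-edge e x i fwd y ∧ χ-edge e x i bwd y)) λ i →
           md-⋀ (λ y → χ-edge e x i fwd y ∧ χ-edge e x i bwd y) λ y → ⊔-lub (md-edge fwd) (md-edge bwd))
    where
    md-edge : ∀ d {i y} → md (χ-edge e x i d y) ≤ suc e
    md-edge d {i} {y} = md-when (arrow T i d x y) _ (subst (_≤ suc e) (sym (md-modal d (χ e y))) (s≤s (md-χ e y)))

  module _ {M : LTS p n} (H : Hom T M) where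
    open Hom H

    hom-labels : ∀ x → M ⊨ labels x at map x
    hom-labels x =
      ⋀-intro M (λ j → when (fprop T j x) (var j)) λ j → when-intro M (fprop T j x) (var j) (pres-prop j x)

    hom-χ : ∀ e x → M ⊨ χ e x at map x
    hom-χ zero    x = hom-labels x
    hom-χ (suc e) x =
      hom-labels x ,
      ⋀-intro M (λ i → ⋀ (λ y → χ-edge e x i fwd y ∧ χ-edge e x i bwd y)) λ i →
      ⋀-intro M (λ y → χ-edge e x i fwd y ∧ χ-edge e x i bwd y) λ y → hom-edge fwd , hom-edge bwd
      where
      hom-edge : ∀ d {i y} → M ⊨ χ-edge e x i d y at map x
      hom-edge d {i} {y} = when-intro M (arrow T i d x y) _ λ a → modal-intro M d (hom-arrow H d a) (hom-χ e y)

  module _ {N : LTS p n} where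

    χ-labels : ∀ {e x s} → N ⊨ χ e x at s → ∀ j → fprop T j x ≡ true → prop N j s
    χ-labels {zero}  {x} h j l = when-elim N (var j) l (⋀-elim N (λ j → when (fprop T j x) (var j)) h j)
    χ-labels {suc e} {x} h j l = when-elim N (var j) l (⋀-elim N (λ j → when (fprop T j x) (var j)) (proj₁ h) j)

    χ-edges : ∀ {e x s} → N ⊨ χ (suc e) x at s → ∀ i y → N ⊨ χ-edge e x i fwd y at s × N ⊨ χ-edge e x i bwd y at s
    χ-edges {e} {x} h i y =
      ⋀-elim N (λ y → χ-edge e x i fwd y ∧ χ-edge e x i bwd y)
        (⋀-elim N (λ i → ⋀ (λ y → χ-edge e x i fwd y ∧ χ-edge e x i bwd y)) (proj₂ h) i) y

    χ-step : ∀ {e x s i} d {y} → N ⊨ χ (suc e) x at s → arrow T i d x y ≡ true →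
             ∃[ t ] (Step N i d s t × N ⊨ χ e y at t)
    χ-step {e} {i = i} fwd {y} h a =
      modal-elim N fwd {φ = χ e y} (when-elim N (modal fwd i (χ e y)) a (proj₁ (χ-edges {e} h i y)))
    χ-step {e} {i = i} bwd {y} h a =
      modal-elim N bwd {φ = χ e y} (when-elim N (modal bwd i (χ e y)) a (proj₂ (χ-edges {e} h i y)))

  -- Given a covering parent map of T of rank ≤ k, a state satisfying χ k at the root is the
  -- image of the root under a homomorphism, built down the parent map one fact at a time.
  module Realise (P : ParentMap T) (covers : ParentMap.CoversFacts P) {k} (bounded : ∀ x → ParentMap.rank P x ≤ k)
                 {N : LTS p n} (χ-root : N ⊨ χ k (root T) at point N) where
    open ParentMap P
    open ParentMapProperties P

    Realised : Fact T → (V → State N) → Set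
    Realised (i , a , b) g = rel N i (g a) (g b)

    child : ∀ {f x y e s} → Links T f x y → N ⊨ χ (suc e) y at s →
            Σ (State N) λ t → N ⊨ χ e x at t × (∀ g → g x ≡ t → g y ≡ s → Realised f g)
    child {i , _ , _} {e = e} (isf , inj₁ (refl , refl)) h =
      let (t , st , ht) = χ-step {e = e} bwd h isf in t , ht , λ g gx gy → subst₂ (rel N i) (sym gx) (sym gy) st
    child {i , _ , _} {e = e} (isf , inj₂ (refl , refl)) h =
      let (t , st , ht) = χ-step {e = e} fwd h isf in t , ht , λ g gx gy → subst₂ (rel N i) (sym gy) (sym gx) st

    Placement : V → ℕ → Set
    Placement x r = Σ (State N) λ t → N ⊨ χ (k ∸ r) x at t

    -- k ∸ r ≡ suc (k ∸ suc r) as suc r ≤ k.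
    deepen : ∀ {r y s} → suc r ≤ k → N ⊨ χ (k ∸ r) y at s → N ⊨ χ (suc (k ∸ suc r)) y at s
    deepen {y = y} {s} r<k = subst (λ d → N ⊨ χ d y at s) (+-∸-assoc 1 r<k)

    place        : ∀ r x → rank x ≡ r → Placement x r
    place-child  : ∀ {r x y f} (e : rank x ≡ suc r) (q : parent x ≡ just (y , f)) →
                   Σ (State N) λ t → N ⊨ χ (k ∸ suc r) x at t ×
                     (∀ g → g x ≡ t → g y ≡ proj₁ (place r y (suc-injective (trans (parent-rank q) e))) → Realised f g)
    place-below  : ∀ r x → rank x ≡ suc r → (m : Maybe (V × Fact T)) → parent x ≡ m → Placement x (suc r)
    place zero    x e = point N , subst (λ z → N ⊨ χ k z at point N) (sym (rank-zero-root e)) χ-root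
    place (suc r) x e = place-below r x e (parent x) refl
    place-child {r} {x} e q =
      child {e = k ∸ suc r} (parent-links q) (deepen (subst (_≤ k) e (bounded x)) (proj₂ (place r _ _)))
    place-below r x e nothing        q = contradiction (trans (sym e) (orphan-rank q)) λ ()
    place-below r x e (just (y , f)) q = let (t , ht , _) = place-child e q in t , ht

    image : V → State N
    image x = proj₁ (place (rank x) x refl)

    place-image : ∀ {r x} (e : rank x ≡ r) → proj₁ (place r x e) ≡ image x
    place-image refl = refl

    image-realises : ∀ {x y f} → parent x ≡ just (y , f) → Realised f image
    image-realises {x} {y} {f} q = realised (parent x) refl q image (sym (place-image e)) refl
      where
      e : rank x ≡ suc (rank y)
      e = sym (parent-rank q)
      -- parent x is generalised so that place-below computes.
      realised : ∀ m (q′ : parent x ≡ m) → m ≡ just (y , f) →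
                 ∀ g → g x ≡ proj₁ (place-below (rank y) x e m q′) → g y ≡ image y → Realised f g
      realised .(just (y , f)) q′ refl g gx gy =
        proj₂ (proj₂ (place-child e q′)) g gx (trans gy (sym (place-image (suc-injective (trans (parent-rank q′) e)))))

    χ⇒hom : Hom T N
    χ⇒hom = record
      { map       = image
      ; pres-prop = λ j x → χ-labels {N = N} {e = k ∸ rank x} (proj₂ (place (rank x) x refl)) j
      ; pres-rel  = λ i u v isf → [ image-realises , image-realises ]′ (covers isf)
      ; pres-pt   = sym (place-image rank-root) }

formula-transfer⇒hom-transfer : ∀ k (M N : LTS p n) → (∀ φ → md φ ≤ k → M ⊨ φ at point M → N ⊨ φ at point N) →
  ∀ T → InA k T → Hom T M → Hom T N
formula-transfer⇒hom-transfer k M N transfer T (_ , acyclic , shallow) H =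
  χ⇒hom (transfer (χ k (root T)) (md-χ k (root T))
                  (subst (λ s → M ⊨ χ k (root T) at s) (Hom.pres-pt H) (hom-χ H k (root T))))
  where
  open Characteristic T
  open BreadthFirst shallow
  open Realise bfs (ParentMapProperties.acyclic⇒covering bfs acyclic) depth-≤

theorem3p5 : ∀ {p n : ℕ} (k : ℕ) (M N : LTS p n) →
    DegreeFinite M → DegreeFinite N →
    (SameFormulas k M N ⇔ HomVecEq k M N)
theorem3p5 k M N _ _ = mk⇔
  (λ same T T∈𝒜 → mk⇔ (formula-transfer⇒hom-transfer k M N (λ φ φ≤k → to (same φ φ≤k)) T T∈𝒜)
                       (formula-transfer⇒hom-transfer k N M (λ φ φ≤k → from (same φ φ≤k)) T T∈𝒜))
  (λ homs φ φ≤k → mk⇔ (hom-transfer⇒formula-transfer k M N (λ T T∈𝒜 → to (homs T T∈𝒜)) φ φ≤k)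
                       (hom-transfer⇒formula-transfer k N M (λ T T∈𝒜 → from (homs T T∈𝒜)) φ φ≤k))
  where open Equivalence
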